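{- Let $D$ be the discriminant of an order in an imaginary quadratic field in which $p$ is inert, with $p\nmid D$, and let $s\in\mathbb{Z}/2p^2$. Then $\mathcal{Q}_{ns,D,s}$ is non-empty if and only if $s^2\equiv\varepsilon D\pmod{4p^2}$. In that case, $\Gamma_{ns}$ acts on $\mathcal{Q}_{ns,D,s}$ and the inclusion $\mathcal{Q}_{ns,D,s}\subseteq\mathcal{Q}_D$ induces a bijection $\mathcal{Q}_{ns,D,s}/\Gamma_{ns}\to\mathcal{Q}_D/\mathrm{SL}_2(\mathbb{Z})$.
   Context: $p$ is an odd prime and $\varepsilon$ an integer that is not a square modulo $p$ with $\varepsilon\equiv1\pmod4$. $M_{ns}=\{\left(\begin{smallmatrix} a&b\\ c&d\end{smallmatrix}\right)\in M_2(\mathbb{Z}): a\equiv d,\ b\varepsilon\equiv c\pmod p\}$, $\Gamma_{ns}=M_{ns}\cap\mathrm{SL}_2(\mathbb{Z})$. $[A,B,C]$ denotes the form $AX^2+BXY+CY^2$ with $A,B,C\in\mathbb{Z}$, and $\mathrm{SL}_2(\mathbb{Z})$ acts on the right by $[A,B,C]\cdot\left(\begin{smallmatrix}\alpha&\beta\\ \gamma&\delta\end{smallmatrix}\right)=[A\alpha^2+B\alpha\gamma+C\gamma^2,\ 2A\alpha\beta+B(\alpha\delta+\beta\gamma)+2C\gamma\delta,\ A\beta^2+B\beta\delta+C\delta^2]$. $\mathcal{Q}_D=\{[A,B,C]:B^2-4AC=D\}$ and, for $s\in\mathbb{Z}/2p^2$, $\mathcal{Q}_{ns,D,s}=\{[A,B,C]\in\mathcal{Q}_D: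 B\equiv A+C\varepsilon\equiv0\pmod p,\ A-C\varepsilon\equiv s\pmod{p^2},\ B\equiv s\pmod 2\}$. -}

module Defs where

open import Data.Nat as ℕ using (ℕ)
open import Data.Integer using (ℤ; +_; _+_; _-_; _*_; _<_; 0ℤ; 1ℤ)
open import Data.Integer.Divisibility using (_∣_)
open import Data.Product using (Σ; ∃; _×_; _,_)
open import Data.Sum using (_⊎_)
open import Relation.Nullary using (¬_)
open import Relation.Binary.PropositionalEquality using (_≡_)

_≡_[mod_] : ℤ → ℤ → ℕ → Set
a ≡ b [mod m ] = (+ m) ∣ (a - b)

NonSquareMod : ℕ → ℤ → Set
NonSquareMod m x = ¬ (∃ λ y → (y * y) ≡ x [mod m ])

-- D is the discriminant of an order in an imaginary quadratic field:
-- D < 0 and D ≡ 0 or 1 (mod 4)  (every such D is the discriminant of the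
-- order of conductor f in Q(√D), where D = f² d_K).
IsImagQuadOrderDisc : ℤ → Set
IsImagQuadOrderDisc D = (D < 0ℤ) × ((D ≡ 0ℤ [mod 4 ]) ⊎ (D ≡ 1ℤ [mod 4 ]))

-- p is inert in the imaginary quadratic field Q(√D) (for p odd, p ∤ D):
-- the Legendre symbol (D/p) = (d_K/p) equals -1, i.e. D is a non-square mod p.
InertIn : ℕ → ℤ → Set
InertIn p D = NonSquareMod p D

-- Binary quadratic forms [A,B,C] = A X² + B XY + C Y².
record Form : Set where
  constructor [_,_,_]
  field
    A B C : ℤ
open Form public

record Mat : Set where
  constructor mat
  field
    α β γ δ : ℤ
open Mat public

det : Mat → ℤ
det (mat a b c d) = a * d - b * c

IsSL2 : Mat → Set
IsSL2 g = det g ≡ 1ℤ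

_·_ : Form → Mat → Form
[ a , b , c ] · mat x y z w =
  [ a * x * x + b * x * z + c * z * z
  , (+ 2) * a * x * y + b * (x * w + y * z) + (+ 2) * c * z * w
  , a * y * y + b * y * w + c * w * w ]

disc : Form → ℤ
disc [ a , b , c ] = b * b - (+ 4) * a * c

InQ : ℤ → Form → Set
InQ D Q = disc Q ≡ D

InΓns : ℕ → ℤ → Mat → Set
InΓns p ε g =
  IsSL2 g × (α g ≡ δ g [mod p ]) × ((β g * ε) ≡ γ g [mod p ])

InQns : ℕ → ℤ → ℤ → ℤ → Form → Set
InQns p ε D s Q =
  InQ D Q
  × (B Q ≡ 0ℤ [mod p ])
  × ((A Q + C Q * ε) ≡ 0ℤ [mod p ])
  × ((A Q - C Q * ε) ≡ s [mod p ℕ.* p ])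
  × (B Q ≡ s [mod 2 ])

{-# OPTIONS --safe #-}
module Submission where

open import Defs
open import Data.Nat as ℕ using (ℕ; zero; suc)
open import Data.Nat.Primality using (Prime; prime[2]; euclidsLemma; prime⇒nonZero; prime⇒nonTrivial)
open import Data.Nat.Divisibility as ℕD using ()
import Data.Nat.Properties as ℕP
open import Data.Integer as ℤ using (ℤ; +_; _*_; _+_; _-_; -_; 0ℤ; 1ℤ)
import Data.Integer.Properties as ℤP
open import Data.Integer.DivMod using (_%ℕ_; _/ℕ_; n%ℕd<d; a≡a%ℕn+[a/ℕn]*n)
open import Data.Integer.Tactic.RingSolver using (solve-∀)
open import Data.Fin as Fin using (Fin; toℕ; splitAt; join)
import Data.Fin.Properties as FinP
open import Data.Product using (∃; ∃₂; _×_; _,_; proj₁; proj₂; map₂; uncurry)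
open import Data.Sum as Sum using (_⊎_; inj₁; inj₂; [_,_]′)
open import Function.Base using (_∘_; id)
open import Function.Bundles using (_⇔_; mk⇔)
open import Relation.Nullary using (¬_; yes; no; contradiction)
open import Relation.Binary.PropositionalEquality
  using (_≡_; _≢_; refl; sym; trans; cong; cong₂; subst; module ≡-Reasoning)

-- Modulo p, the conditions defining 𝒬_{ns,D,s} come down to B ≡ 0 and 2A ≡ s: once s² ≡ εD (mod 4p²),
-- the discriminant forces A + Cε ≡ 0 (mod p), then A - Cε ≡ s (mod p²) because A - Cε + s ≡ 2s is a
-- unit, and B ≡ s (mod 2). Modulo p such a form is a multiple of the norm form εX² - Y², so g ∈ SL₂(ℤ)
-- carries one such form to another exactly when g preserves εX² - Y² modulo p, which together with
-- det g = 1 says g ∈ Γ_ns. Every class of 𝒬_D meets 𝒬_{ns,D,s}: as p is inert, p ∤ A, so the form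
-- represents s/2 modulo p (a pigeonhole count of squares); the representing vector is the first
-- column of a matrix of SL₂(ℤ) modulo p, and a shear then clears B.

-- Signed divisibility is opened only inside modules: at top level `_∣_` is the unsigned
-- relation in terms of which Defs and the statement are phrased.
module SignedDivisibility where

  open import Data.Integer.Divisibility.Signed public

  infixr 6 _*∣_
  infixl 5 _∣+_ _∣-_

  ∣-≡ : ∀ {k x y} → x ≡ y → k ∣ y → k ∣ x
  ∣-≡ {k} x≡y = subst (k ∣_) (sym x≡y)

  _*∣_ : ∀ {k x} y → k ∣ x → k ∣ y * x
  y *∣ k∣x = ∣n⇒∣m*n y k∣x

  _∣+_ : ∀ {k x y} → k ∣ x → k ∣ y → k ∣ x + y
  _∣+_ = ∣m∣n⇒∣m+n

  _∣-_ : ∀ {k x y} → k ∣ x → k ∣ y → k ∣ x - y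
  _∣-_ = ∣m∣n⇒∣m-n

  ≡⇒∣- : ∀ {k x y} → x ≡ y → k ∣ x - y
  ≡⇒∣- {x = x} refl = divides 0ℤ (ℤP.+-inverseʳ x)

  *-pres-∣ : ∀ {k l x y} → k ∣ x → l ∣ y → k * l ∣ x * y
  *-pres-∣ {k} {l} (divides m x≡mk) (divides n y≡nl) =
    divides (m * n) (trans (cong₂ _*_ x≡mk y≡nl) (regroup m k n l))
    where
    regroup : ∀ m k n l → m * k * (n * l) ≡ m * n * (k * l)
    regroup = solve-∀

  ∣⇒≡0-mod : ∀ {m x} → + m ∣ x → x ≡ 0ℤ [mod m ]
  ∣⇒≡0-mod {x = x} m∣x = ∣⇒∣ᵤ (∣-≡ (ℤP.+-identityʳ x) m∣x)

  ≡0-mod⇒∣ : ∀ {m x} → x ≡ 0ℤ [mod m ] → + m ∣ x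
  ≡0-mod⇒∣ {x = x} x≡0 = ∣-≡ (sym (ℤP.+-identityʳ x)) (∣ᵤ⇒∣ x≡0)

open SignedDivisibility using (divides; ∣ᵤ⇒∣)

¬2∣n⇒n≡1+k+k : ∀ {n} → ¬ 2 ℕD.∣ n → ∃ λ k → n ≡ suc (k ℕ.+ k)
¬2∣n⇒n≡1+k+k {zero} 2∤0 = contradiction (ℕD.divides 0 refl) 2∤0
¬2∣n⇒n≡1+k+k {suc zero} _ = 0 , refl
¬2∣n⇒n≡1+k+k {suc (suc n)} 2∤2+n
  with k , n≡1+k+k ← ¬2∣n⇒n≡1+k+k (2∤2+n ∘ ℕD.∣m∣n⇒∣m+n ℕD.∣-refl)
  = suc k , cong (suc ∘ suc) (trans n≡1+k+k (sym (ℕP.+-suc k k)))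

nonsquare⇒≢0 : ∀ {m x} → NonSquareMod m x → ¬ x ≡ 0ℤ [mod m ]
nonsquare⇒≢0 {m} {x} x-nonsquare x≡0 = x-nonsquare (0ℤ , subst (m ℕD.∣_) (ℤP.∣i-j∣≡∣j-i∣ x 0ℤ) x≡0)

difference-of-squares : ∀ x y → x * x - y * y ≡ (x - y) * (x + y)
difference-of-squares = solve-∀

value : Form → ℤ → ℤ → ℤ
value Q x y = A Q * x * x + B Q * x * y + C Q * y * y

_⋆_ : Mat → Mat → Mat
mat a b c d ⋆ mat e f g h = mat (a * e + b * g) (a * f + b * h) (c * e + d * g) (c * f + d * h)

shear : ℤ → Mat
shear t = mat 1ℤ t 0ℤ 1ℤ

form-≡ : ∀ {a b c a′ b′ c′} → a ≡ a′ → b ≡ b′ → c ≡ c′ → [ a , b , c ] ≡ [ a′ , b′ , c′ ]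
form-≡ refl refl refl = refl

value-· : ∀ Q g u v → value (Q · g) u v ≡ value Q (α g * u + β g * v) (γ g * u + δ g * v)
value-· Q (mat x y z w) u v = expand (A Q) (B Q) (C Q) x y z w u v
  where
  expand : ∀ a b c x y z w u v →
    (a * x * x + b * x * z + c * z * z) * u * u
      + (+ 2 * a * x * y + b * (x * w + y * z) + + 2 * c * z * w) * u * v
      + (a * y * y + b * y * w + c * w * w) * v * v
    ≡ a * (x * u + y * v) * (x * u + y * v) + b * (x * u + y * v) * (z * u + w * v)
      + c * (z * u + w * v) * (z * u + w * v)
  expand = solve-∀

·-⋆ : ∀ Q g h → (Q · g) · h ≡ Q · (g ⋆ h)
·-⋆ Q g@(mat x y z w) h@(mat e f k l) =
  form-≡ (value-· Q g e k) (polar (A Q) (B Q) (C Q) x y z w e f k l) (value-· Q g f l)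
  where
  polar : ∀ a b c x y z w e f k l →
    + 2 * (a * x * x + b * x * z + c * z * z) * e * f
      + (+ 2 * a * x * y + b * (x * w + y * z) + + 2 * c * z * w) * (e * l + f * k)
      + + 2 * (a * y * y + b * y * w + c * w * w) * k * l
    ≡ + 2 * a * (x * e + y * k) * (x * f + y * l)
      + b * ((x * e + y * k) * (z * f + w * l) + (x * f + y * l) * (z * e + w * k))
      + + 2 * c * (z * e + w * k) * (z * f + w * l)
  polar = solve-∀

det-⋆ : ∀ g h → det (g ⋆ h) ≡ det g * det h
det-⋆ (mat a b c d) (mat e f k l) = expand a b c d e f k l
  where
  expand : ∀ a b c d e f k l →
    (a * e + b * k) * (c * f + d * l) - (a * f + b * l) * (c * e + d * k)
    ≡ (a * d - b * c) * (e * l - f * k)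
  expand = solve-∀

⋆-SL2 : ∀ g h → IsSL2 g → IsSL2 h → IsSL2 (g ⋆ h)
⋆-SL2 g h g-SL2 h-SL2 = trans (det-⋆ g h) (cong₂ _*_ g-SL2 h-SL2)

disc-· : ∀ Q g → disc (Q · g) ≡ det g * det g * disc Q
disc-· Q (mat x y z w) = expand (A Q) (B Q) (C Q) x y z w
  where
  expand : ∀ a b c x y z w →
    (+ 2 * a * x * y + b * (x * w + y * z) + + 2 * c * z * w)
      * (+ 2 * a * x * y + b * (x * w + y * z) + + 2 * c * z * w)
      - + 4 * (a * x * x + b * x * z + c * z * z) * (a * y * y + b * y * w + c * w * w)
    ≡ (x * w - y * z) * (x * w - y * z) * (b * b - + 4 * a * c)
  expand = solve-∀

SL2-preserves-disc : ∀ Q {g} → IsSL2 g → disc (Q · g) ≡ disc Q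
SL2-preserves-disc Q {g} g-SL2 =
  trans (disc-· Q g) (trans (cong (λ d → d * d * disc Q) g-SL2) (ℤP.*-identityˡ (disc Q)))

shear-SL2 : ∀ t → IsSL2 (shear t)
shear-SL2 = expand
  where
  expand : ∀ t → 1ℤ * 1ℤ - t * 0ℤ ≡ 1ℤ
  expand = solve-∀

A-shear : ∀ Q t → A (Q · shear t) ≡ A Q
A-shear Q t = expand (A Q) (B Q) (C Q)
  where
  expand : ∀ a b c → a * 1ℤ * 1ℤ + b * 1ℤ * 0ℤ + c * 0ℤ * 0ℤ ≡ a
  expand = solve-∀

principal-form : ∀ {D} → (D ≡ 0ℤ [mod 4 ]) ⊎ (D ≡ 1ℤ [mod 4 ]) → ∃ λ Q → InQ D Q
principal-form {D} (inj₁ D≡0) with divides k D-0≡k*4 ← ∣ᵤ⇒∣ {i = D - 0ℤ} D≡0 =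
  [ 1ℤ , 0ℤ , - k ] , trans (expand k) (trans (sym D-0≡k*4) (ℤP.+-identityʳ D))
  where
  expand : ∀ k → 0ℤ * 0ℤ - + 4 * 1ℤ * - k ≡ k * + 4
  expand = solve-∀
principal-form {D} (inj₂ D≡1) with divides k D-1≡k*4 ← ∣ᵤ⇒∣ {i = D - 1ℤ} D≡1 =
  [ 1ℤ , 1ℤ , - k ] , trans (expand k) (trans (cong (_+ 1ℤ) (sym D-1≡k*4)) (restore D))
  where
  expand : ∀ k → 1ℤ * 1ℤ - + 4 * 1ℤ * - k ≡ k * + 4 + 1ℤ
  expand = solve-∀
  restore : ∀ D → D - 1ℤ + 1ℤ ≡ D
  restore = solve-∀

module Modulo (p : ℕ) (p-prime : Prime p) where

  open SignedDivisibility

  instance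
    p-nonZero : ℕ.NonZero p
    p-nonZero = prime⇒nonZero p-prime

  P : ℤ
  P = + p

  p∣p² : P ∣ P * P
  p∣p² = ∣m⇒∣m*n P ∣-refl

  euclid : ∀ {x y} → P ∣ x * y → (P ∣ x) ⊎ (P ∣ y)
  euclid {x} {y} p∣xy = Sum.map (∣ᵤ⇒∣ {P}) (∣ᵤ⇒∣ {P})
    (euclidsLemma ℤ.∣ x ∣ ℤ.∣ y ∣ p-prime (subst (p ℕD.∣_) (ℤP.abs-* x y) (∣⇒∣ᵤ p∣xy)))

  ∤x∧∤y⇒∤xy : ∀ {x y} → ¬ P ∣ x → ¬ P ∣ y → ¬ P ∣ x * y
  ∤x∧∤y⇒∤xy p∤x p∤y = [ p∤x , p∤y ]′ ∘ euclid

  ∣xy∧∤y⇒∣x : ∀ {x y} → P ∣ x * y → ¬ P ∣ y → P ∣ x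
  ∣xy∧∤y⇒∣x p∣xy p∤y = [ id , (λ p∣y → contradiction p∣y p∤y) ]′ (euclid p∣xy)

  ∣xy∧∤x⇒∣y : ∀ {x y} → P ∣ x * y → ¬ P ∣ x → P ∣ y
  ∣xy∧∤x⇒∣y p∣xy p∤x = [ (λ p∣x → contradiction p∣x p∤x) , id ]′ (euclid p∣xy)

  p²∣xy∧∤y⇒p²∣x : ∀ {x y} → P * P ∣ x * y → ¬ P ∣ y → P * P ∣ x
  p²∣xy∧∤y⇒p²∣x {x} {y} p²∣xy p∤y = lift (∣xy∧∤y⇒∣x (∣-trans p∣p² p²∣xy) p∤y)
    where
    lift : P ∣ x → P * P ∣ x
    lift (divides k x≡kP) = lift′ (∣xy∧∤y⇒∣x p∣ky p∤y)
      where
      swap : ∀ k y P → k * y * P ≡ k * P * y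
      swap = solve-∀
      p∣ky : P ∣ k * y
      p∣ky = *-cancelʳ-∣ P (∣-≡ (trans (swap k y P) (cong (_* y) (sym x≡kP))) p²∣xy)
      lift′ : P ∣ k → P * P ∣ x
      lift′ (divides l k≡lP) =
        divides l (trans x≡kP (trans (cong (_* P) k≡lP) (ℤP.*-assoc l P P)))

  ∣-sq-diff : ∀ {u v} → P ∣ u - v → P ∣ u * u - v * v
  ∣-sq-diff {u} {v} p∣u-v = ∣-≡ (difference-of-squares u v) (∣m⇒∣m*n (u + v) p∣u-v)

  ∣∧∣x∣<p⇒x≡0 : ∀ {x} → ℤ.∣ x ∣ ℕ.< p → P ∣ x → x ≡ 0ℤ
  ∣∧∣x∣<p⇒x≡0 {x} ∣x∣<p p∣x with ℤ.∣ x ∣ in ∣x∣≡n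
  ... | zero = ℤP.∣i∣≡0⇒i≡0 ∣x∣≡n
  ... | suc n = contradiction (subst (p ℕD.∣_) ∣x∣≡n (∣⇒∣ᵤ p∣x)) (ℕD.>⇒∤ ∣x∣<p)

  <p∧∣-⇒≡ : ∀ {i j} → i ℕ.< p → j ℕ.< p → P ∣ + i - + j → i ≡ j
  <p∧∣-⇒≡ {i} {j} i<p j<p p∣i-j =
    ℤP.+-injective (ℤP.i-j≡0⇒i≡j (+ i) (+ j) (∣∧∣x∣<p⇒x≡0 ∣i-j∣<p p∣i-j))
    where
    ∣i-j∣<p : ℤ.∣ + i - + j ∣ ℕ.< p
    ∣i-j∣<p = ℕP.≤-<-trans
      (subst (ℕ._≤ i ℕ.⊔ j) (cong ℤ.∣_∣ (sym (ℤP.m-n≡m⊖n i j))) (ℤP.∣m⊝n∣≤m⊔n i j))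
      (ℕP.⊔-lub i<p j<p)

  InjectiveMod : ℕ → (ℕ → ℤ) → Set
  InjectiveMod n f = ∀ {i j} → i ℕ.< n → j ℕ.< n → P ∣ f i - f j → i ≡ j

  residue : ℤ → Fin p
  residue x = Fin.fromℕ< (n%ℕd<d x p)

  residue-≡⇒∣ : ∀ x y → residue x ≡ residue y → P ∣ x - y
  residue-≡⇒∣ x y same = divides (x /ℕ p - y /ℕ p) (begin
    x - y
      ≡⟨ cong₂ _-_ (a≡a%ℕn+[a/ℕn]*n x p) (a≡a%ℕn+[a/ℕn]*n y p) ⟩
    (+ (x %ℕ p) + x /ℕ p * P) - (+ (y %ℕ p) + y /ℕ p * P)
      ≡⟨ cong (λ r → (+ (x %ℕ p) + x /ℕ p * P) - (+ r + y /ℕ p * P)) (sym x%p≡y%p) ⟩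
    (+ (x %ℕ p) + x /ℕ p * P) - (+ (x %ℕ p) + y /ℕ p * P)
      ≡⟨ cancel (+ (x %ℕ p)) (x /ℕ p) (y /ℕ p) P ⟩
    (x /ℕ p - y /ℕ p) * P ∎)
    where
    open ≡-Reasoning
    x%p≡y%p : x %ℕ p ≡ y %ℕ p
    x%p≡y%p = FinP.fromℕ<-injective (x %ℕ p) (y %ℕ p) (n%ℕd<d x p) (n%ℕd<d y p) same
    cancel : ∀ r u v m → (r + u * m) - (r + v * m) ≡ (u - v) * m
    cancel = solve-∀

  collision : ∀ {m n f g} → p ℕ.< m ℕ.+ n → InjectiveMod m f → InjectiveMod n g →
              ∃₂ λ i j → P ∣ f i - g j
  collision {m} {n} {f} {g} p<m+n f-injective g-injective =
    distinct-pair (FinP.pigeonhole p<m+n (residue-of ∘ splitAt m))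
    where
    residue-of : Fin m ⊎ Fin n → Fin p
    residue-of = [ residue ∘ f ∘ toℕ , residue ∘ g ∘ toℕ ]′

    splitAt-injective : ∀ {k k′} → splitAt m k ≡ splitAt m k′ → k ≡ k′
    splitAt-injective {k} {k′} eq =
      trans (sym (FinP.join-splitAt m n k)) (trans (cong (join m n) eq) (FinP.join-splitAt m n k′))

    residue-injective : ∀ {l} h → InjectiveMod l h → (a a′ : Fin l) →
                        residue (h (toℕ a)) ≡ residue (h (toℕ a′)) → a ≡ a′
    residue-injective h h-injective a a′ same = FinP.toℕ-injective
      (h-injective (FinP.toℕ<n a) (FinP.toℕ<n a′) (residue-≡⇒∣ (h (toℕ a)) (h (toℕ a′)) same))

    meet : ∀ u v → u ≢ v → residue-of u ≡ residue-of v → ∃₂ λ i j → P ∣ f i - g j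
    meet (inj₁ a) (inj₁ a′) a≢a′ same = contradiction (cong inj₁ (residue-injective f f-injective a a′ same)) a≢a′
    meet (inj₁ a) (inj₂ b) _ same = toℕ a , toℕ b , residue-≡⇒∣ (f (toℕ a)) (g (toℕ b)) same
    meet (inj₂ b) (inj₁ a) _ same = toℕ a , toℕ b , residue-≡⇒∣ (f (toℕ a)) (g (toℕ b)) (sym same)
    meet (inj₂ b) (inj₂ b′) b≢b′ same = contradiction (cong inj₂ (residue-injective g g-injective b b′ same)) b≢b′

    distinct-pair : (∃₂ λ k k′ → k Fin.< k′ × residue-of (splitAt m k) ≡ residue-of (splitAt m k′)) →
                    ∃₂ λ i j → P ∣ f i - g j
    distinct-pair (k , k′ , k<k′ , same) =
      meet (splitAt m k) (splitAt m k′) (FinP.<⇒≢ k<k′ ∘ splitAt-injective) same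

  inverse : ∀ {a} → ¬ P ∣ a → ∃ λ t → P ∣ a * t - 1ℤ
  inverse {a} p∤a = witness
    (collision {f = λ i → a * + i} {g = λ _ → 1ℤ} (ℕP.m<m+n p ℕ.z<s) multiples-injective constant-injective)
    where
    factor : ∀ a x y → a * x - a * y ≡ a * (x - y)
    factor = solve-∀
    multiples-injective : InjectiveMod p (λ i → a * + i)
    multiples-injective i<p j<p p∣ai-aj =
      <p∧∣-⇒≡ i<p j<p (∣xy∧∤x⇒∣y (∣-≡ (sym (factor a _ _)) p∣ai-aj) p∤a)
    constant-injective : InjectiveMod 1 (λ _ → 1ℤ)
    constant-injective i<1 j<1 _ = trans (ℕP.n<1⇒n≡0 i<1) (sym (ℕP.n<1⇒n≡0 j<1))
    witness : (∃₂ λ i j → P ∣ a * + i - 1ℤ) → ∃ λ t → P ∣ a * t - 1ℤ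
    witness (i , _ , p∣ai-1) = + i , p∣ai-1

  nonsquare-disc⇒∤A : ∀ Q → NonSquareMod p (disc Q) → ¬ P ∣ A Q
  nonsquare-disc⇒∤A Q disc-nonsquare p∣A =
    disc-nonsquare (B Q , ∣⇒∣ᵤ (∣-≡ (expand (A Q) (B Q) (C Q)) (+ 4 * C Q *∣ p∣A)))
    where
    expand : ∀ a b c → b * b - (b * b - + 4 * a * c) ≡ + 4 * c * a
    expand = solve-∀

  value-cong : ∀ Q {x x′ y y′} → P ∣ x′ - x → P ∣ y′ - y → P ∣ value Q x′ y′ - value Q x y
  value-cong Q {x} {x′} {y} {y′} p∣x′-x p∣y′-y =
    ∣-≡ (expand (A Q) (B Q) (C Q) x x′ y y′)
      (A Q * (x′ + x) *∣ p∣x′-x ∣+ B Q * x′ *∣ p∣y′-y ∣+ B Q * y *∣ p∣x′-x ∣+ C Q * (y′ + y) *∣ p∣y′-y)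
    where
    expand : ∀ a b c x x′ y y′ →
      (a * x′ * x′ + b * x′ * y′ + c * y′ * y′) - (a * x * x + b * x * y + c * y * y)
      ≡ a * (x′ + x) * (x′ - x) + b * x′ * (y′ - y) + b * y * (x′ - x) + c * (y′ + y) * (y′ - y)
    expand = solve-∀

  ∤value⇒∤x⊎∤y : ∀ Q {x y} → ¬ P ∣ value Q x y → (¬ P ∣ x) ⊎ (¬ P ∣ y)
  ∤value⇒∤x⊎∤y Q {x} {y} p∤Qxy with P ∣? x | P ∣? y
  ... | no p∤x | _ = inj₁ p∤x
  ... | yes _ | no p∤y = inj₂ p∤y
  ... | yes p∣x | yes p∣y = contradiction (A Q * x *∣ p∣x ∣+ B Q * x *∣ p∣y ∣+ C Q * y *∣ p∣y) p∤Qxy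

  column-lift : ∀ {x y} → (¬ P ∣ x) ⊎ (¬ P ∣ y) → ∃ λ g → IsSL2 g × P ∣ α g - x × P ∣ γ g - y
  column-lift {x} {y} (inj₁ p∤x) = lift (inverse p∤x)
    where
    det≡1 : ∀ x u → x * - u - - 1ℤ * (1ℤ + x * u) ≡ 1ℤ
    det≡1 = solve-∀
    γ-error : ∀ x y t → 1ℤ + x * ((y - 1ℤ) * t) - y ≡ (y - 1ℤ) * (x * t - 1ℤ)
    γ-error = solve-∀
    lift : (∃ λ t → P ∣ x * t - 1ℤ) → ∃ λ g → IsSL2 g × P ∣ α g - x × P ∣ γ g - y
    lift (t , p∣xt-1) =
      mat x (- 1ℤ) (1ℤ + x * ((y - 1ℤ) * t)) (- ((y - 1ℤ) * t)) , det≡1 x ((y - 1ℤ) * t) ,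
      ≡⇒∣- {x = x} refl , ∣-≡ (γ-error x y t) ((y - 1ℤ) *∣ p∣xt-1)
  column-lift {x} {y} (inj₂ p∤y) = lift (inverse p∤y)
    where
    det≡1 : ∀ y u → (1ℤ + u * y) * 1ℤ - u * y ≡ 1ℤ
    det≡1 = solve-∀
    α-error : ∀ x y t → 1ℤ + (x - 1ℤ) * t * y - x ≡ (x - 1ℤ) * (y * t - 1ℤ)
    α-error = solve-∀
    lift : (∃ λ t → P ∣ y * t - 1ℤ) → ∃ λ g → IsSL2 g × P ∣ α g - x × P ∣ γ g - y
    lift (t , p∣yt-1) =
      mat (1ℤ + (x - 1ℤ) * t * y) ((x - 1ℤ) * t) y 1ℤ , det≡1 y ((x - 1ℤ) * t) ,
      ∣-≡ (α-error x y t) ((x - 1ℤ) *∣ p∣yt-1) , ≡⇒∣- {x = y} refl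

  move-to-A : ∀ Q {x y} → ¬ P ∣ value Q x y → ∃ λ g → IsSL2 g × P ∣ A (Q · g) - value Q x y
  move-to-A Q {x} {y} p∤Qxy = lift (column-lift (∤value⇒∤x⊎∤y Q p∤Qxy))
    where
    lift : (∃ λ g → IsSL2 g × P ∣ α g - x × P ∣ γ g - y) →
           ∃ λ g → IsSL2 g × P ∣ A (Q · g) - value Q x y
    lift (g , g-SL2 , p∣αg-x , p∣γg-y) = g , g-SL2 , value-cong Q {x} {α g} {y} {γ g} p∣αg-x p∣γg-y

  clear-B : ∀ Q → ¬ P ∣ + 2 * A Q → ∃ λ t → P ∣ B (Q · shear t)
  clear-B Q p∤2A = shift (inverse p∤2A)
    where
    expand : ∀ a b c u →
      + 2 * a * 1ℤ * - (b * u) + b * (1ℤ * 1ℤ + - (b * u) * 0ℤ) + + 2 * c * 0ℤ * 1ℤ ≡ - b * (+ 2 * a * u - 1ℤ)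
    expand = solve-∀
    shift : (∃ λ u → P ∣ + 2 * A Q * u - 1ℤ) → ∃ λ t → P ∣ B (Q · shear t)
    shift (u , p∣2Au-1) = - (B Q * u) , ∣-≡ (expand (A Q) (B Q) (C Q) u) (- B Q *∣ p∣2Au-1)

  module Odd (p-odd : ¬ 2 ℕD.∣ p) where

    p∤2 : ¬ P ∣ + 2
    p∤2 p∣2 = p-odd (subst (2 ℕD.∣_) (sym p≡2) ℕD.∣-refl)
      where
      p≡2 : p ≡ 2
      p≡2 = ℕP.≤-antisym (ℕD.∣⇒≤ (∣⇒∣ᵤ p∣2)) (ℕ.nonTrivial⇒n>1 p {{prime⇒nonTrivial p-prime}})

    p∤4 : ¬ P ∣ + 4
    p∤4 = ∤x∧∤y⇒∤xy p∤2 p∤2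

    4p²≡ : + (4 ℕ.* p ℕ.* p) ≡ + 4 * (P * P)
    4p²≡ = trans (ℤP.pos-* (4 ℕ.* p) p) (trans (cong (_* P) (ℤP.pos-* 4 p)) (ℤP.*-assoc (+ 4) P P))

    crt : ∀ {x} → + 4 ∣ x → P * P ∣ x → + (4 ℕ.* p ℕ.* p) ∣ x
    crt {x} (divides k x≡k*4) p²∣x = lift (p²∣xy∧∤y⇒p²∣x {k} (∣-≡ (sym x≡k*4) p²∣x) p∤4)
      where
      open ≡-Reasoning
      rotate : ∀ l m → l * m * + 4 ≡ l * (+ 4 * m)
      rotate = solve-∀
      lift : P * P ∣ k → + (4 ℕ.* p ℕ.* p) ∣ x
      lift (divides l k≡l*p²) = divides l (begin
        x                     ≡⟨ x≡k*4 ⟩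
        k * + 4               ≡⟨ cong (_* + 4) k≡l*p² ⟩
        l * (P * P) * + 4     ≡⟨ rotate l (P * P) ⟩
        l * (+ 4 * (P * P))   ≡⟨ cong (l *_) (sym 4p²≡) ⟩
        l * + (4 ℕ.* p ℕ.* p) ∎)

    h : ℕ
    h = proj₁ (¬2∣n⇒n≡1+k+k p-odd)

    p≡1+h+h : p ≡ suc (h ℕ.+ h)
    p≡1+h+h = proj₂ (¬2∣n⇒n≡1+k+k p-odd)

    <1+h⇒<p : ∀ {i} → i ℕ.< suc h → i ℕ.< p
    <1+h⇒<p {i} (ℕ.s≤s i≤h) = subst (i ℕ.<_) (sym p≡1+h+h) (ℕ.s≤s (ℕP.≤-trans i≤h (ℕP.m≤m+n h h)))

    squares-injective : InjectiveMod (suc h) (λ i → + i * + i)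
    squares-injective {i} {j} i<1+h j<1+h p∣i²-j²
      with euclid (∣-≡ (sym (difference-of-squares (+ i) (+ j))) p∣i²-j²)
    ... | inj₁ p∣i-j = <p∧∣-⇒≡ (<1+h⇒<p i<1+h) (<1+h⇒<p j<1+h) p∣i-j
    ... | inj₂ p∣i+j = trans (ℕP.m+n≡0⇒m≡0 i i+j≡0) (sym (ℕP.m+n≡0⇒n≡0 i i+j≡0))
      where
      i+j<p : i ℕ.+ j ℕ.< p
      i+j<p = subst (i ℕ.+ j ℕ.<_) (sym p≡1+h+h) (ℕ.s≤s (ℕP.+-mono-≤ (ℕ.s≤s⁻¹ i<1+h) (ℕ.s≤s⁻¹ j<1+h)))
      i+j≡0 : i ℕ.+ j ≡ 0
      i+j≡0 = ℤP.+-injective (∣∧∣x∣<p⇒x≡0 i+j<p p∣i+j)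

    X²≡c+dy² : ∀ {d} → ¬ P ∣ d → ∀ c → ∃₂ λ X y → P ∣ X * X - (c + d * (y * y))
    X²≡c+dy² {d} p∤d c = witness
      (collision {f = λ i → + i * + i} {g = λ j → c + d * (+ j * + j)}
        p<2+h+h squares-injective shifted-injective)
      where
      p<2+h+h : p ℕ.< suc h ℕ.+ suc h
      p<2+h+h = subst (ℕ._< suc h ℕ.+ suc h) (sym p≡1+h+h) (ℕ.s≤s (ℕP.+-monoʳ-< h (ℕP.n<1+n h)))
      shift : ∀ c d x y → (c + d * x) - (c + d * y) ≡ d * (x - y)
      shift = solve-∀
      shifted-injective : InjectiveMod (suc h) (λ j → c + d * (+ j * + j))
      shifted-injective i<1+h j<1+h p∣Δ =
        squares-injective i<1+h j<1+h (∣xy∧∤x⇒∣y (∣-≡ (sym (shift c d _ _)) p∣Δ) p∤d)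
      witness : (∃₂ λ i j → P ∣ + i * + i - (c + d * (+ j * + j))) →
                ∃₂ λ X y → P ∣ X * X - (c + d * (y * y))
      witness (i , j , p∣i²-c-dj²) = + i , + j , p∣i²-c-dj²

    represents : ∀ Q → ¬ P ∣ A Q → ¬ P ∣ disc Q → ∀ c → ∃₂ λ x y → P ∣ value Q x y - c
    represents Q p∤A p∤disc c = combine (X²≡c+dy² p∤disc (+ 4 * A Q * c)) (inverse (∤x∧∤y⇒∤xy p∤2 p∤A))
      where
      linear : ∀ a b X y t → + 2 * a * ((X - b * y) * t) + b * y - X ≡ (X - b * y) * (+ 2 * a * t - 1ℤ)
      linear = solve-∀
      complete-square : ∀ a b c x y X k →
        + 4 * a * (a * x * x + b * x * y + c * y * y - k)
        ≡ (+ 2 * a * x + b * y) * (+ 2 * a * x + b * y) - X * X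
          + (X * X - (+ 4 * a * k + (b * b - + 4 * a * c) * (y * y)))
      complete-square = solve-∀
      -- x is chosen so that 2Ax + By ≡ X; then 4A·Q(x, y) = (2Ax + By)² - disc·y² ≡ 4Ac.
      combine : (∃₂ λ X y → P ∣ X * X - (+ 4 * A Q * c + disc Q * (y * y))) →
                (∃ λ t → P ∣ + 2 * A Q * t - 1ℤ) → ∃₂ λ x y → P ∣ value Q x y - c
      combine (X , y , p∣X²-4Ac-disc·y²) (t , p∣2At-1) = x , y , ∣xy∧∤x⇒∣y
        (∣-≡ (complete-square (A Q) (B Q) (C Q) x y X c)
          (∣-sq-diff {+ 2 * A Q * x + B Q * y} {X} p∣2Ax+By-X ∣+ p∣X²-4Ac-disc·y²))
        (∤x∧∤y⇒∤xy p∤4 p∤A)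
        where
        x : ℤ
        x = (X - B Q * y) * t
        p∣2Ax+By-X : P ∣ + 2 * A Q * x + B Q * y - X
        p∣2Ax+By-X = ∣-≡ (linear (A Q) (B Q) X y t) ((X - B Q * y) *∣ p∣2At-1)

    half : ℤ
    half = proj₁ (inverse p∤2)

    p∣2half-1 : P ∣ + 2 * half - 1ℤ
    p∣2half-1 = proj₂ (inverse p∤2)

module NonSplitCartan
  (p : ℕ) (p-prime : Prime p) (p-odd : ¬ 2 ℕD.∣ p)
  (ε : ℤ) (ε≢0 : ¬ ε ≡ 0ℤ [mod p ]) (ε≡1 : ε ≡ 1ℤ [mod 4 ])
  (D : ℤ) (D-inert : InertIn p D) (s : ℤ)
  where

  open SignedDivisibility
  open Modulo p p-prime
  open Odd p-odd

  p∤ε : ¬ P ∣ ε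
  p∤ε = ε≢0 ∘ ∣⇒≡0-mod

  p∤D : ¬ P ∣ D
  p∤D = nonsquare⇒≢0 D-inert ∘ ∣⇒≡0-mod

  p∤A : ∀ Q → InQ D Q → ¬ P ∣ A Q
  p∤A Q disc≡D = nonsquare-disc⇒∤A Q (subst (NonSquareMod p) (sym disc≡D) D-inert)

  p²≡ : + (p ℕ.* p) ≡ P * P
  p²≡ = ℤP.pos-* p p

  mod-p²⇒p²∣ : ∀ {x y} → x ≡ y [mod p ℕ.* p ] → P * P ∣ x - y
  mod-p²⇒p²∣ {x} {y} x≡y = subst (_∣ x - y) p²≡ (∣ᵤ⇒∣ {i = x - y} x≡y)

  p²∣⇒mod-p² : ∀ {x y} → P * P ∣ x - y → x ≡ y [mod p ℕ.* p ]
  p²∣⇒mod-p² {x} {y} p²∣x-y = ∣⇒∣ᵤ (subst (_∣ x - y) (sym p²≡) p²∣x-y)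

  4∣ε-1 : + 4 ∣ ε - 1ℤ
  4∣ε-1 = ∣ᵤ⇒∣ {i = ε - 1ℤ} ε≡1

  Adapted : Form → Set
  Adapted Q = P ∣ B Q × P ∣ + 2 * A Q - s

  member⇒adapted : ∀ Q → InQns p ε D s Q → Adapted Q
  member⇒adapted [ a , b , c ] (_ , b≡0 , a+cε≡0 , a-cε≡s , _) =
    ≡0-mod⇒∣ {x = b} b≡0 ,
    ∣-≡ (expand a c s ε) (≡0-mod⇒∣ {x = a + c * ε} a+cε≡0 ∣+ ∣-trans p∣p² (mod-p²⇒p²∣ {a - c * ε} a-cε≡s))
    where
    expand : ∀ a c s ε → + 2 * a - s ≡ a + c * ε + (a - c * ε - s)
    expand = solve-∀

  member⇒s²≡εD : ∀ Q → InQns p ε D s Q → (s * s) ≡ (ε * D) [mod 4 ℕ.* p ℕ.* p ]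
  member⇒s²≡εD [ a , b , c ] (disc≡D , b≡0 , a+cε≡0 , a-cε≡s , b≡s) =
    ∣⇒∣ᵤ (subst (λ d → + (4 ℕ.* p ℕ.* p) ∣ s * s - ε * d) disc≡D (crt 4∣s²-εdisc p²∣s²-εdisc))
    where
    p∣b : P ∣ b
    p∣b = ≡0-mod⇒∣ {x = b} b≡0
    p∣a+cε : P ∣ a + c * ε
    p∣a+cε = ≡0-mod⇒∣ {x = a + c * ε} a+cε≡0
    p²∣a-cε-s : P * P ∣ a - c * ε - s
    p²∣a-cε-s = mod-p²⇒p²∣ {a - c * ε} a-cε≡s
    2∣b-s : + 2 ∣ b - s
    2∣b-s = ∣ᵤ⇒∣ {i = b - s} b≡s
    modulo-p² : ∀ a b c s ε →
      s * s - ε * (b * b - + 4 * a * c)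
      ≡ (a + c * ε) * (a + c * ε) - ε * (b * b) - (a - c * ε - s) * (a - c * ε + s)
    modulo-p² = solve-∀
    modulo-4 : ∀ a b c s ε →
      s * s - ε * (b * b - + 4 * a * c)
      ≡ + 4 * (ε * a * c) - (b - s) * (b - s) - + 2 * (s * (b - s)) - (ε - 1ℤ) * (b * b)
    modulo-4 = solve-∀
    p²∣s²-εdisc : P * P ∣ s * s - ε * (b * b - + 4 * a * c)
    p²∣s²-εdisc = ∣-≡ (modulo-p² a b c s ε)
      (*-pres-∣ p∣a+cε p∣a+cε ∣- ε *∣ *-pres-∣ p∣b p∣b ∣- ∣m⇒∣m*n (a - c * ε + s) p²∣a-cε-s)
    4∣s²-εdisc : + 4 ∣ s * s - ε * (b * b - + 4 * a * c)
    4∣s²-εdisc = ∣-≡ (modulo-4 a b c s ε)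
      (∣m⇒∣m*n (ε * a * c) ∣-refl ∣- *-pres-∣ 2∣b-s 2∣b-s ∣- *-monoʳ-∣ (+ 2) (s *∣ 2∣b-s)
        ∣- ∣m⇒∣m*n (b * b) 4∣ε-1)

  module _ (s²≡εD : (s * s) ≡ (ε * D) [mod 4 ℕ.* p ℕ.* p ]) where

    4p²∣s²-εD : + (4 ℕ.* p ℕ.* p) ∣ s * s - ε * D
    4p²∣s²-εD = ∣ᵤ⇒∣ {i = s * s - ε * D} s²≡εD

    p²∣s²-εD : P * P ∣ s * s - ε * D
    p²∣s²-εD = ∣-trans (∣-≡ 4p²≡ (+ 4 *∣ ∣-refl)) 4p²∣s²-εD

    4∣s²-εD : + 4 ∣ s * s - ε * D
    4∣s²-εD = ∣-trans (∣-≡ 4p²≡ (∣m⇒∣m*n (P * P) ∣-refl)) 4p²∣s²-εD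

    at-disc : ∀ Q {k} → InQ D Q → k ∣ s * s - ε * D → k ∣ s * s - ε * disc Q
    at-disc Q {k} disc≡D = subst (λ d → k ∣ s * s - ε * d) (sym disc≡D)

    p∤s : ¬ P ∣ s
    p∤s p∣s = ∤x∧∤y⇒∤xy p∤ε p∤D (∣-≡ (expand s ε D) (s *∣ p∣s ∣- ∣-trans p∣p² p²∣s²-εD))
      where
      expand : ∀ s ε D → ε * D ≡ s * s - (s * s - ε * D)
      expand = solve-∀

    ∣2v-s⇒∤2v : ∀ {v} → P ∣ + 2 * v - s → ¬ P ∣ + 2 * v
    ∣2v-s⇒∤2v {v} p∣2v-s p∣2v = p∤s (∣-≡ (expand v s) (p∣2v ∣- p∣2v-s))
      where
      expand : ∀ v s → s ≡ + 2 * v - (+ 2 * v - s)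
      expand = solve-∀

    2∣B-s : ∀ Q → InQ D Q → + 2 ∣ B Q - s
    2∣B-s Q disc≡D =
      [ id , (λ 2∣B+s → ∣-≡ (shift (B Q) s) (2∣B+s ∣- ∣m⇒∣m*n s ∣-refl)) ]′
        (Modulo.euclid 2 prime[2] (∣-≡ (expand (A Q) (B Q) (C Q) s ε)
          (∣m⇒∣m*n (+ 2 * A Q * C Q) ∣-refl ∣- ∣-trans 2∣4 (at-disc Q disc≡D 4∣s²-εD)
            ∣- ∣m⇒∣m*n (disc Q) (∣-trans 2∣4 4∣ε-1))))
      where
      2∣4 : + 2 ∣ + 4
      2∣4 = divides (+ 2) refl
      shift : ∀ b s → b - s ≡ b + s - + 2 * s
      shift = solve-∀
      expand : ∀ a b c s ε →
        (b - s) * (b + s)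
        ≡ + 2 * (+ 2 * a * c) - (s * s - ε * (b * b - + 4 * a * c)) - (ε - 1ℤ) * (b * b - + 4 * a * c)
      expand = solve-∀

    adapted⇒p∣A+Cε : ∀ Q → InQ D Q → Adapted Q → P ∣ A Q + C Q * ε
    adapted⇒p∣A+Cε Q disc≡D (p∣B , p∣2A-s) = ∣xy∧∤x⇒∣y
      (∣-≡ (expand (A Q) (B Q) (C Q) s ε)
        ((+ 2 * A Q + s) *∣ p∣2A-s ∣+ at-disc Q disc≡D (∣-trans p∣p² p²∣s²-εD) ∣+ ε * B Q *∣ p∣B))
      (∤x∧∤y⇒∤xy p∤4 (p∤A Q disc≡D))
      where
      expand : ∀ a b c s ε →
        + 4 * a * (a + c * ε)
        ≡ (+ 2 * a + s) * (+ 2 * a - s) + (s * s - ε * (b * b - + 4 * a * c)) + ε * b * b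
      expand = solve-∀

    adapted⇒member : ∀ Q → InQ D Q → Adapted Q → InQns p ε D s Q
    adapted⇒member Q disc≡D adapted@(p∣B , p∣2A-s) =
      disc≡D , ∣⇒≡0-mod p∣B , ∣⇒≡0-mod p∣A+Cε , p²∣⇒mod-p² {A Q - C Q * ε} p²∣A-Cε-s ,
      ∣⇒∣ᵤ (2∣B-s Q disc≡D)
      where
      p∣A+Cε : P ∣ A Q + C Q * ε
      p∣A+Cε = adapted⇒p∣A+Cε Q disc≡D adapted
      p∣A-Cε-s : P ∣ A Q - C Q * ε - s
      p∣A-Cε-s = ∣-≡ (minus (A Q) (C Q) s ε) (p∣2A-s ∣- p∣A+Cε)
        where
        minus : ∀ a c s ε → a - c * ε - s ≡ + 2 * a - s - (a + c * ε)
        minus = solve-∀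
      p∤A-Cε+s : ¬ P ∣ A Q - C Q * ε + s
      p∤A-Cε+s p∣A-Cε+s = ∤x∧∤y⇒∤xy p∤2 p∤s (∣-≡ (twice (A Q) (C Q) s ε) (p∣A-Cε+s ∣- p∣A-Cε-s))
        where
        twice : ∀ a c s ε → + 2 * s ≡ a - c * ε + s - (a - c * ε - s)
        twice = solve-∀
      p²∣A-Cε-s : P * P ∣ A Q - C Q * ε - s
      p²∣A-Cε-s = p²∣xy∧∤y⇒p²∣x
        (∣-≡ (factor (A Q) (B Q) (C Q) s ε)
          (*-pres-∣ p∣A+Cε p∣A+Cε ∣- at-disc Q disc≡D p²∣s²-εD ∣- ε *∣ *-pres-∣ p∣B p∣B))
        p∤A-Cε+s
        where
        factor : ∀ a b c s ε →
          (a - c * ε - s) * (a - c * ε + s)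
          ≡ (a + c * ε) * (a + c * ε) - (s * s - ε * (b * b - + 4 * a * c)) - ε * (b * b)
        factor = solve-∀

    Γns-preserves-adapted : ∀ Q g → InQ D Q → Adapted Q → InΓns p ε g → Adapted (Q · g)
    Γns-preserves-adapted Q (mat x y z w) disc≡D adapted@(p∣B , p∣2A-s) (det≡1 , x≡w , yε≡z) =
      ∣-≡ (B-expansion (A Q) (B Q) (C Q) x y z w ε)
        ((x * w + y * z) *∣ p∣B ∣+ + 2 * x * y *∣ p∣A+Cε ∣- + 2 * C Q * w *∣ p∣yε-z
          ∣- + 2 * C Q * ε * y *∣ p∣x-w) ,
      ∣-≡ (A-expansion (A Q) (B Q) (C Q) x y z w ε s)
        (+ 2 * x * z *∣ p∣B ∣+ + 2 * A Q * x *∣ p∣x-w ∣+ + 2 * y * z *∣ p∣A+Cε ∣- + 2 * C Q * z *∣ p∣yε-z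
          ∣+ (x * w - y * z) *∣ p∣2A-s ∣+ s *∣ ≡⇒∣- det≡1)
      where
      p∣A+Cε : P ∣ A Q + C Q * ε
      p∣A+Cε = adapted⇒p∣A+Cε Q disc≡D adapted
      p∣x-w : P ∣ x - w
      p∣x-w = ∣ᵤ⇒∣ {i = x - w} x≡w
      p∣yε-z : P ∣ y * ε - z
      p∣yε-z = ∣ᵤ⇒∣ {i = y * ε - z} yε≡z
      B-expansion : ∀ a b c x y z w ε →
        + 2 * a * x * y + b * (x * w + y * z) + + 2 * c * z * w
        ≡ (x * w + y * z) * b + + 2 * x * y * (a + c * ε)
          - + 2 * c * w * (y * ε - z) - + 2 * c * ε * y * (x - w)
      B-expansion = solve-∀
      A-expansion : ∀ a b c x y z w ε s →
        + 2 * (a * x * x + b * x * z + c * z * z) - s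
        ≡ + 2 * x * z * b + + 2 * a * x * (x - w) + + 2 * y * z * (a + c * ε) - + 2 * c * z * (y * ε - z)
          + (x * w - y * z) * (+ 2 * a - s) + s * (x * w - y * z - 1ℤ)
      A-expansion = solve-∀

    adapted-pair⇒Γns : ∀ Q g → InQ D Q → Adapted Q → IsSL2 g → Adapted (Q · g) → InΓns p ε g
    adapted-pair⇒Γns Q (mat x y z w) disc≡D adapted@(p∣B , p∣2A-s) det≡1 (p∣B′ , p∣2A′-s) =
      det≡1 , ∣⇒∣ᵤ p∣x-w , ∣⇒∣ᵤ p∣yε-z
      where
      -- Modulo p, ε·2Q(X, Y) ≡ s(εX² - Y²): the columns of g have norm ε and are orthogonal
      -- for εX² - Y², which together with det g = 1 forces w ≡ x and z ≡ εy.
      p∣2Cε+s : P ∣ + 2 * C Q * ε + s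
      p∣2Cε+s = ∣-≡ (expand (A Q) (C Q) s ε) (+ 2 *∣ adapted⇒p∣A+Cε Q disc≡D adapted ∣- p∣2A-s)
        where
        expand : ∀ a c s ε → + 2 * c * ε + s ≡ + 2 * (a + c * ε) - (+ 2 * a - s)
        expand = solve-∀
      p∣det-1 : P ∣ x * w - y * z - 1ℤ
      p∣det-1 = ≡⇒∣- det≡1
      p∣N-ε : P ∣ ε * x * x - z * z - ε
      p∣N-ε = ∣xy∧∤x⇒∣y
        (∣-≡ (norm (A Q) (B Q) (C Q) x z ε s)
          (ε *∣ p∣2A′-s ∣- ε * x * x *∣ p∣2A-s ∣- + 2 * ε * x * z *∣ p∣B ∣- z * z *∣ p∣2Cε+s))
        p∤s
        where
        norm : ∀ a b c x z ε s →
          s * (ε * x * x - z * z - ε)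
          ≡ ε * (+ 2 * (a * x * x + b * x * z + c * z * z) - s) - ε * x * x * (+ 2 * a - s)
            - + 2 * ε * x * z * b - z * z * (+ 2 * c * ε + s)
        norm = solve-∀
      p∣polar : P ∣ ε * x * y - z * w
      p∣polar = ∣xy∧∤x⇒∣y
        (∣-≡ (polar (A Q) (B Q) (C Q) x y z w ε s)
          (ε *∣ p∣B′ ∣- ε * x * y *∣ p∣2A-s ∣- ε * (x * w + y * z) *∣ p∣B ∣- z * w *∣ p∣2Cε+s))
        p∤s
        where
        polar : ∀ a b c x y z w ε s →
          s * (ε * x * y - z * w)
          ≡ ε * (+ 2 * a * x * y + b * (x * w + y * z) + + 2 * c * z * w) - ε * x * y * (+ 2 * a - s)
            - ε * (x * w + y * z) * b - z * w * (+ 2 * c * ε + s)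
        polar = solve-∀
      p∣yε-z : P ∣ y * ε - z
      p∣yε-z = ∣-≡ (expand x y z w ε) (x *∣ p∣polar ∣+ z *∣ p∣det-1 ∣- y *∣ p∣N-ε)
        where
        expand : ∀ x y z w ε →
          y * ε - z ≡ x * (ε * x * y - z * w) + z * (x * w - y * z - 1ℤ) - y * (ε * x * x - z * z - ε)
        expand = solve-∀
      p∣x-w : P ∣ x - w
      p∣x-w = ∣xy∧∤x⇒∣y (∣-≡ (expand x y z w ε) (w *∣ p∣N-ε ∣- z *∣ p∣polar ∣- ε * x *∣ p∣det-1)) p∤ε
        where
        expand : ∀ x y z w ε →
          ε * (x - w) ≡ w * (ε * x * x - z * z - ε) - z * (ε * x * y - z * w) - ε * x * (x * w - y * z - 1ℤ)
        expand = solve-∀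

    s/2-represented : ∀ Q → InQ D Q → ∃₂ λ x y → P ∣ + 2 * value Q x y - s
    s/2-represented Q disc≡D =
      double (represents Q (p∤A Q disc≡D) (subst (λ d → ¬ P ∣ d) (sym disc≡D) p∤D) (half * s))
      where
      expand : ∀ v h s → + 2 * v - s ≡ + 2 * (v - h * s) + s * (+ 2 * h - 1ℤ)
      expand = solve-∀
      double : (∃₂ λ x y → P ∣ value Q x y - half * s) → ∃₂ λ x y → P ∣ + 2 * value Q x y - s
      double (x , y , p∣Qxy-hs) = x , y , ∣-≡ (expand (value Q x y) half s) (+ 2 *∣ p∣Qxy-hs ∣+ s *∣ p∣2half-1)

    A≡s/2-representative : ∀ Q → InQ D Q → ∃ λ g → IsSL2 g × P ∣ + 2 * A (Q · g) - s
    A≡s/2-representative Q disc≡D = move (s/2-represented Q disc≡D)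
      where
      expand : ∀ a v s → + 2 * a - s ≡ + 2 * (a - v) + (+ 2 * v - s)
      expand = solve-∀
      move : (∃₂ λ x y → P ∣ + 2 * value Q x y - s) → ∃ λ g → IsSL2 g × P ∣ + 2 * A (Q · g) - s
      move (x , y , p∣2Qxy-s) = moved (move-to-A Q (∣2v-s⇒∤2v {value Q x y} p∣2Qxy-s ∘ (+ 2 *∣_)))
        where
        moved : (∃ λ g → IsSL2 g × P ∣ A (Q · g) - value Q x y) →
                ∃ λ g → IsSL2 g × P ∣ + 2 * A (Q · g) - s
        moved (g , g-SL2 , p∣Ag-Qxy) =
          g , g-SL2 , ∣-≡ (expand (A (Q · g)) (value Q x y) s) (+ 2 *∣ p∣Ag-Qxy ∣+ p∣2Qxy-s)

    adapted-representative : ∀ Q → InQ D Q → ∃ λ g → IsSL2 g × Adapted (Q · g)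
    adapted-representative Q disc≡D = shear-off (A≡s/2-representative Q disc≡D)
      where
      shear-off : (∃ λ g → IsSL2 g × P ∣ + 2 * A (Q · g) - s) → ∃ λ g → IsSL2 g × Adapted (Q · g)
      shear-off (g , g-SL2 , p∣2A-s) = sheared (clear-B (Q · g) (∣2v-s⇒∤2v {A (Q · g)} p∣2A-s))
        where
        sheared : (∃ λ t → P ∣ B ((Q · g) · shear t)) → ∃ λ g → IsSL2 g × Adapted (Q · g)
        sheared (t , p∣B) =
          g ⋆ shear t , ⋆-SL2 g (shear t) g-SL2 (shear-SL2 t) ,
          subst Adapted (·-⋆ Q g (shear t))
            (p∣B , subst (λ a → P ∣ + 2 * a - s) (sym (A-shear (Q · g) t)) p∣2A-s)

    SL2-image⇒member : ∀ Q g → InQ D Q → IsSL2 g → Adapted (Q · g) → InQns p ε D s (Q · g)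
    SL2-image⇒member Q g disc≡D g-SL2 =
      adapted⇒member (Q · g) (trans (SL2-preserves-disc Q g-SL2) disc≡D)

    Γns-acts : (Q : Form) (g : Mat) → InQns p ε D s Q → InΓns p ε g → InQns p ε D s (Q · g)
    Γns-acts Q g Q∈@(disc≡D , _) g∈Γns@(g-SL2 , _) =
      SL2-image⇒member Q g disc≡D g-SL2 (Γns-preserves-adapted Q g disc≡D (member⇒adapted Q Q∈) g∈Γns)

    every-class-meets : (Q : Form) → InQ D Q →
                        ∃ λ Q′ → InQns p ε D s Q′ × (∃ λ g → IsSL2 g × (Q · g ≡ Q′))
    every-class-meets Q disc≡D = represent (adapted-representative Q disc≡D)
      where
      represent : (∃ λ g → IsSL2 g × Adapted (Q · g)) →
                  ∃ λ Q′ → InQns p ε D s Q′ × (∃ λ g → IsSL2 g × (Q · g ≡ Q′))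
      represent (g , g-SL2 , adapted) = Q · g , SL2-image⇒member Q g disc≡D g-SL2 adapted , g , g-SL2 , refl

    nonempty : (D ≡ 0ℤ [mod 4 ]) ⊎ (D ≡ 1ℤ [mod 4 ]) → ∃ λ Q → InQns p ε D s Q
    nonempty D-mod-4 = map₂ proj₁ (uncurry every-class-meets (principal-form D-mod-4))

    SL2-equivalent⇒Γns-equivalent : (Q₁ Q₂ : Form) → InQns p ε D s Q₁ → InQns p ε D s Q₂ →
                                    (∃ λ g → IsSL2 g × (Q₁ · g ≡ Q₂)) →
                                    ∃ λ γ → InΓns p ε γ × (Q₁ · γ ≡ Q₂)
    SL2-equivalent⇒Γns-equivalent Q₁ _ Q₁∈@(disc≡D , _) Q₂∈ (g , g-SL2 , refl) =
      g , adapted-pair⇒Γns Q₁ g disc≡D (member⇒adapted Q₁ Q₁∈) g-SL2 (member⇒adapted (Q₁ · g) Q₂∈) , refl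

open import Data.Integer.Divisibility using (_∣_)

proposition5p2 :
    (p : ℕ) → Prime p → ¬ (2 ℕD.∣ p) →
    (ε : ℤ) → NonSquareMod p ε → ε ≡ 1ℤ [mod 4 ] →
    (D : ℤ) → IsImagQuadOrderDisc D → InertIn p D → ¬ ((+ p) ∣ D) →
    (s : ℤ) →
    ((∃ λ Q → InQns p ε D s Q) ⇔ ((s * s) ≡ (ε * D) [mod 4 ℕ.* p ℕ.* p ]))
    × (((s * s) ≡ (ε * D) [mod 4 ℕ.* p ℕ.* p ]) →
        -- Γ_ns acts on 𝒬_{ns,D,s}
        ((Q : Form) (g : Mat) → InQns p ε D s Q → InΓns p ε g → InQns p ε D s (Q · g))
        -- surjectivity of 𝒬_{ns,D,s}/Γ_ns → 𝒬_D/SL₂(ℤ)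
        × ((Q : Form) → InQ D Q →
             ∃ λ Q′ → InQns p ε D s Q′ × (∃ λ g → IsSL2 g × (Q · g ≡ Q′)))
        -- injectivity
        × ((Q₁ Q₂ : Form) → InQns p ε D s Q₁ → InQns p ε D s Q₂ →
             (∃ λ g → IsSL2 g × (Q₁ · g ≡ Q₂)) →
             ∃ λ γ → InΓns p ε γ × (Q₁ · γ ≡ Q₂)))
proposition5p2 p p-prime p-odd ε ε-nonsquare ε≡1 D (_ , D-mod-4) D-inert _ s =
  mk⇔ (uncurry member⇒s²≡εD) (λ s²≡εD → nonempty s²≡εD D-mod-4) ,
  λ s²≡εD → Γns-acts s²≡εD , every-class-meets s²≡εD , SL2-equivalent⇒Γns-equivalent s²≡εD
  where
  open NonSplitCartan p p-prime p-odd ε (nonsquare⇒≢0 ε-nonsquare) ε≡1 D D-inert s
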